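{- Let $G$ be a finite, simple, connected graph of order $n\geq 2$ which is randomly $k$-dimensional. Then $\omega(G)\leq k+1$. Moreover, $\omega(G)=k+1$ if and only if $G=K_n$.
   Context: $\omega(G)$ is the number of vertices in a maximum clique of $G$. $d(x,y)$ is the distance in $G$. For an ordered set $W=\{w_1,\ldots,w_k\}\subseteq V(G)$ and $v\in V(G)$, $r(v|W)=(d(v,w_1),\ldots,d(v,w_k))$. $W$ is a resolving set if distinct vertices have distinct representations with respect to $W$. The metric dimension $\beta(G)$ is the minimum size of a resolving set; a resolving set of size $\beta(G)$ is a basis. $G$ is randomly $k$-dimensional if $\beta(G)=k$ and every $k$-subset of $V(G)$ is a basis of $G$. -}

module Defs where

open import Data.Nat using (ℕ; zero; suc; _≤_)
open import Data.Bool using (Bool; true; false; _∧_; _∨_; if_then_else_)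
open import Data.Fin using (Fin; _≟_)
open import Data.Fin.Subset using (Subset; _∈_; ∣_∣)
open import Data.List using (List; allFin)
open import Data.Bool.ListAction using (any)
open import Data.Product using (Σ; ∃; _×_)
open import Relation.Nullary using (¬_)
open import Relation.Nullary.Decidable using (isYes)
open import Relation.Binary.PropositionalEquality using (_≡_)

record Graph (n : ℕ) : Set where
  field
    adj   : Fin n → Fin n → Bool
    sym   : ∀ x y → adj x y ≡ adj y x
    irrefl : ∀ x → adj x x ≡ false
open Graph public

module _ {n : ℕ} (G : Graph n) where

  Adj : Fin n → Fin n → Set
  Adj x y = adj G x y ≡ true

  data Walk : Fin n → Fin n → ℕ → Set where
    [] : ∀ {x} → Walk x x zero
    _∷_ : ∀ {x y z m} → Adj x y → Walk y z m → Walk x z (suc m)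

  Connected : Set
  Connected = ∀ x y → ∃ λ m → Walk x y m

  reach : ℕ → Fin n → Fin n → Bool
  reach zero x y = isYes (x ≟ y)
  reach (suc k) x y = reach k x y ∨ any (λ z → reach k x z ∧ adj G z y) (allFin n)

  private
    leastFrom : (ℕ → Bool) → ℕ → ℕ → ℕ
    leastFrom p i zero = i
    leastFrom p i (suc fuel) = if p i then i else leastFrom p (suc i) fuel

  -- the distance d(x,y): length of a shortest walk (= shortest path) from x to y.
  -- (Shortest walks have length < n; for disconnected pairs it returns n,
  -- which is irrelevant for connected graphs.)
  dist : Fin n → Fin n → ℕ
  dist x y = leastFrom (λ k → reach k x y) zero n

  -- W resolves G: distinct vertices have distinct distance vectors to W
  -- (r(u|W) = r(v|W) iff d(u,w) = d(v,w) for every w ∈ W, in the order of W)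
  Resolving : Subset n → Set
  Resolving W = ∀ u v → (∀ w → w ∈ W → dist u w ≡ dist v w) → u ≡ v

  MetricDim : ℕ → Set
  MetricDim k = (Σ (Subset n) λ W → Resolving W × ∣ W ∣ ≡ k)
              × (∀ W → Resolving W → k ≤ ∣ W ∣)

  IsBasis : Subset n → Set
  IsBasis W = Resolving W × (∀ W′ → Resolving W′ → ∣ W ∣ ≤ ∣ W′ ∣)

  RandomlyDim : ℕ → Set
  RandomlyDim k = MetricDim k × (∀ W → ∣ W ∣ ≡ k → IsBasis W)

  IsClique : Subset n → Set
  IsClique C = ∀ x y → x ∈ C → y ∈ C → ¬ (x ≡ y) → Adj x y

  Complete : Set
  Complete = ∀ x y → ¬ (x ≡ y) → Adj x y

-- Every k-set of a randomly k-dimensional graph is resolving, so no k-set may have two distinct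
-- vertices at equal distances from all of its members.  Two vertices u, v of a clique C are at
-- distance 1 from all of C - u - v, hence |C| ≤ k + 1.  Let C be a clique of size k + 1 and x ∉ C
-- a neighbour of c ∈ C.  For each c′ ∈ C, x has a non-neighbour in C - c′, for otherwise x and c′
-- are both at distance 1 from the k-set C - c′; this yields c₁ ∈ C - c and c₂ ∈ C - c₁ not
-- adjacent to x.  Both are at distance 1 from C - c₁ - c₂ and at distance 2 from x (through c),
-- so the k-set (C - c₁ - c₂) ∪ {x} does not resolve them.  Hence C is closed under adjacency, and
-- by connectivity it is the whole vertex set.  Conversely, in K_n all vertices but one form a
-- resolving set, so k + 1 ≤ n.
module Submission where

open import Data.Bool using (Bool; true; false; _∧_; _∨_) renaming (_≟_ to _≟ᵇ_)
open import Data.Bool.Properties using (∨-zeroʳ; T-≡; if-cong)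
open import Data.Bool.ListAction using (any)
open import Data.Fin using (Fin; zero; suc; _≟_)
open import Data.Fin.Properties using (any?)
open import Data.Fin.Subset
  using (Subset; _∈_; _∉_; _⊆_; _-_; _∪_; ⁅_⁆; ⊤; ⊥; ∣_∣; inside; outside; Nonempty)
open import Data.Fin.Subset.Properties
  using (_∈?_; ∈⊤; ∣⊥∣≡0; ⊥⊆; x∈⁅y⁆⇒x≡y; x∈p∪q⁻; p─q⊆p; p─⊥≡p; ∪-identityʳ; x∈p∧x≢y⇒x∈p-y)
open import Data.List using (List; []; _∷_; allFin)
open import Data.List.Membership.Propositional using () renaming (_∈_ to _∈ₗ_)
open import Data.List.Membership.Propositional.Properties using (∈-allFin)
import Data.List.Relation.Unary.Any as Any
open import Data.List.Relation.Unary.Any.Properties using (any⁺)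
open import Data.Nat using (ℕ; zero; suc; _≤_; _<_; z≤n; s≤s; s≤s⁻¹; _≤?_)
open import Data.Nat.Properties using (suc-injective; ≰⇒>; ≤-antisym; ≤-trans)
open import Data.Product using (Σ; ∃; _×_; _,_; proj₁; proj₂)
open import Data.Sum using (inj₁; inj₂)
open import Data.Vec using (here; there) renaming (_∷_ to _∷ᵥ_)
open import Function.Base using (_∘_)
open import Function.Bundles using (_⇔_; mk⇔; Equivalence)
open import Relation.Nullary using (¬_; Dec; yes; no; contradiction; _×-dec_; ¬?)
open import Relation.Binary.PropositionalEquality

open import Defs hiding (sym)

private
  variable
    A : Set
    l m n k : ℕ
    P : A → Bool
    as : List A
    c u v w x y : Fin n
    p C W : Subset n

any-≡-true : ∀ {a} → P a ≡ true → a ∈ₗ as → any P as ≡ true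
any-≡-true {P = P} Pa≡true a∈as =
  Equivalence.to T-≡ (any⁺ P (Any.map (λ { refl → Equivalence.from T-≡ Pa≡true }) a∈as))

any-≡-false : (∀ a → P a ≡ false) → any P as ≡ false
any-≡-false {as = []}     _     = refl
any-≡-false {as = a ∷ as} Pa≡false rewrite Pa≡false a = any-≡-false {as = as} Pa≡false

0<∣p∣⇒Nonempty : 0 < ∣ p ∣ → Nonempty p
0<∣p∣⇒Nonempty {p = inside  ∷ᵥ p} _     = zero , here
0<∣p∣⇒Nonempty {p = outside ∷ᵥ p} 0<∣p∣ with 0<∣p∣⇒Nonempty 0<∣p∣
... | x , x∈p = suc x , there x∈p

x∉p-x : ∀ (p : Subset n) x → x ∉ p - x
x∉p-x (_ ∷ᵥ p) (suc x) (there x∈p-x) = x∉p-x p x x∈p-x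

x∈p-y⇒x≢y : x ∈ p - y → x ≢ y
x∈p-y⇒x≢y {p = p} x∈p-x refl = x∉p-x p _ x∈p-x

x∈p⇒1+∣p-x∣≡∣p∣ : x ∈ p → suc ∣ p - x ∣ ≡ ∣ p ∣
x∈p⇒1+∣p-x∣≡∣p∣ {x = zero}  {p = inside  ∷ᵥ p} here          = cong (suc ∘ ∣_∣) (p─⊥≡p p)
x∈p⇒1+∣p-x∣≡∣p∣ {x = suc x} {p = inside  ∷ᵥ p} (there x∈p) = cong suc (x∈p⇒1+∣p-x∣≡∣p∣ x∈p)
x∈p⇒1+∣p-x∣≡∣p∣ {x = suc x} {p = outside ∷ᵥ p} (there x∈p) = x∈p⇒1+∣p-x∣≡∣p∣ x∈p

x∉p⇒∣p∪⁅x⁆∣≡1+∣p∣ : x ∉ p → ∣ p ∪ ⁅ x ⁆ ∣ ≡ suc ∣ p ∣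
x∉p⇒∣p∪⁅x⁆∣≡1+∣p∣ {x = zero}  {p = inside  ∷ᵥ p} x∉p = contradiction here x∉p
x∉p⇒∣p∪⁅x⁆∣≡1+∣p∣ {x = zero}  {p = outside ∷ᵥ p} _   = cong (suc ∘ ∣_∣) (∪-identityʳ p)
x∉p⇒∣p∪⁅x⁆∣≡1+∣p∣ {x = suc x} {p = inside  ∷ᵥ p} x∉p = cong suc (x∉p⇒∣p∪⁅x⁆∣≡1+∣p∣ (x∉p ∘ there))
x∉p⇒∣p∪⁅x⁆∣≡1+∣p∣ {x = suc x} {p = outside ∷ᵥ p} x∉p = x∉p⇒∣p∪⁅x⁆∣≡1+∣p∣ (x∉p ∘ there)

∃-member-removal : suc m ≤ ∣ p ∣ → ∃ λ x → x ∈ p × m ≤ ∣ p - x ∣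
∃-member-removal {m} 1+m≤∣p∣ with 0<∣p∣⇒Nonempty (≤-trans (s≤s z≤n) 1+m≤∣p∣)
... | x , x∈p = x , x∈p , s≤s⁻¹ (subst (suc m ≤_) (sym (x∈p⇒1+∣p-x∣≡∣p∣ x∈p)) 1+m≤∣p∣)

∃-⊆-of-size : ∀ (p : Subset n) → k ≤ ∣ p ∣ → ∃ λ q → q ⊆ p × ∣ q ∣ ≡ k
∃-⊆-of-size {n}     {k = zero}  p              _      = ⊥ , ⊥⊆ , ∣⊥∣≡0 n
∃-⊆-of-size {suc n} {suc k} (outside ∷ᵥ p) k≤∣p∣ with ∃-⊆-of-size p k≤∣p∣
... | q , q⊆p , ∣q∣≡k = outside ∷ᵥ q , (λ { (there x∈q) → there (q⊆p x∈q) }) , ∣q∣≡k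
∃-⊆-of-size {suc n} {suc k} (inside ∷ᵥ p) k≤∣p∣ with ∃-⊆-of-size p (s≤s⁻¹ k≤∣p∣)
... | q , q⊆p , ∣q∣≡k = inside ∷ᵥ q , (λ { here → here ; (there x∈q) → there (q⊆p x∈q) }) , cong suc ∣q∣≡k

module _ (G : Graph n) where

  Adj⇒≢ : Adj G x y → x ≢ y
  Adj⇒≢ {x} adj refl with trans (sym adj) (irrefl G x)
  ... | ()

  Adj-sym : Adj G x y → Adj G y x
  Adj-sym {x} {y} adj = trans (Graph.sym G y x) adj

  Adj? : ∀ x y → Dec (Adj G x y)
  Adj? x y = adj G x y ≟ᵇ true

  ¬Adj⇒adj≡false : ¬ Adj G x y → adj G x y ≡ false
  ¬Adj⇒adj≡false {x} {y} ¬adj with adj G x y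
  ... | true  = contradiction refl ¬adj
  ... | false = refl

  reach-zero-refl : ∀ x → reach G 0 x x ≡ true
  reach-zero-refl x with x ≟ x
  ... | yes _   = refl
  ... | no x≢x  = contradiction refl x≢x

  reach-zero-≢ : x ≢ y → reach G 0 x y ≡ false
  reach-zero-≢ {x} {y} x≢y with x ≟ y
  ... | yes x≡y = contradiction x≡y x≢y
  ... | no _    = refl

  reach-suc : ∀ {z} m → reach G m x y ≡ true → Adj G y z → reach G (suc m) x z ≡ true
  reach-suc {x} {y} {z} m reach-y adj =
    trans (cong (reach G m x z ∨_) (any-≡-true (cong₂ _∧_ reach-y adj) (∈-allFin y))) (∨-zeroʳ _)

  reach-one-≢ : x ≢ y → ¬ Adj G x y → reach G 1 x y ≡ false
  reach-one-≢ {x} {y} x≢y ¬adj rewrite reach-zero-≢ x≢y = any-≡-false {as = allFin n} step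
    where
    step : ∀ z → (reach G 0 x z ∧ adj G z y) ≡ false
    step z with x ≟ z
    ... | yes refl = ¬Adj⇒adj≡false ¬adj
    ... | no _     = refl

dist-refl : (G : Graph n) → ∀ x → dist G x x ≡ 0
dist-refl {suc n} G x = if-cong (reach-zero-refl G x)

dist-adj : (G : Graph n) → Adj G x y → dist G x y ≡ 1
dist-adj {suc zero}    {zero} {zero} G adj = contradiction refl (Adj⇒≢ G adj)
dist-adj {suc (suc n)} {x}    {y}    G adj =
  trans (if-cong (reach-zero-≢ G (Adj⇒≢ G adj))) (if-cong (reach-suc G 0 (reach-zero-refl G x) adj))

-- For n = 2 the search in dist runs out of fuel at 2 before consulting reach 2.
dist-common-neighbour : (G : Graph n) → ∀ {z} → x ≢ y → ¬ Adj G x y → Adj G x z → Adj G z y → dist G x y ≡ 2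
dist-common-neighbour {suc zero}          {zero} {zero} G x≢y _ _ _ = contradiction refl x≢y
dist-common-neighbour {suc (suc zero)}    G x≢y ¬adj _ _ =
  trans (if-cong (reach-zero-≢ G x≢y)) (if-cong (reach-one-≢ G x≢y ¬adj))
dist-common-neighbour {suc (suc (suc n))} {x} G x≢y ¬adj adj-xz adj-zy =
  trans (if-cong (reach-zero-≢ G x≢y)) (trans (if-cong (reach-one-≢ G x≢y ¬adj))
    (if-cong (reach-suc G {x = x} 1 (reach-suc G 0 (reach-zero-refl G x) adj-xz) adj-zy)))

module _ (G : Graph n) where

  AdjClosed : Subset n → Set
  AdjClosed C = ∀ {x y} → x ∈ C → Adj G x y → y ∈ C

  Walk⇒∈ : AdjClosed C → Walk G x y l → x ∈ C → y ∈ C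
  Walk⇒∈ closed []           x∈C = x∈C
  Walk⇒∈ closed (adj ∷ walk) x∈C = Walk⇒∈ closed walk (closed x∈C adj)

  connected∧closed⇒∈ : Connected G → Nonempty C → AdjClosed C → ∀ y → y ∈ C
  connected∧closed⇒∈ connected (x , x∈C) closed y = Walk⇒∈ closed (proj₂ (connected x y)) x∈C

  clique-dist≡1 : IsClique G C → u ∈ C → w ∈ C - u → dist G u w ≡ 1
  clique-dist≡1 {C} {u} {w} clique u∈C w∈C-u =
    dist-adj G (clique u w u∈C (p─q⊆p C ⁅ u ⁆ w∈C-u) (≢-sym (x∈p-y⇒x≢y w∈C-u)))

  clique-equidistant : IsClique G C → u ∈ C → v ∈ C → w ∈ C - u - v → dist G u w ≡ dist G v w
  clique-equidistant {C} {u} clique u∈C v∈C w∈C-u-v =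
    trans (clique-dist≡1 clique u∈C w∈C-u) (sym (clique-dist≡1 clique v∈C w∈C-v))
    where
    w∈C-u = p─q⊆p (C - u) _ w∈C-u-v
    w∈C-v = x∈p∧x≢y⇒x∈p-y (p─q⊆p C ⁅ u ⁆ w∈C-u) (x∈p-y⇒x≢y w∈C-u-v)

  clique-equidistant-with-outsider : IsClique G C → c ∈ C → Adj G c x → x ∉ C →
                                     u ∈ C → v ∈ C → ¬ Adj G x u → ¬ Adj G x v →
                                     w ∈ (C - u - v) ∪ ⁅ x ⁆ → dist G u w ≡ dist G v w
  clique-equidistant-with-outsider {C} {c} {x} {u} {v} clique c∈C adj-cx x∉C u∈C v∈C ¬adj-u ¬adj-v w∈W
    with x∈p∪q⁻ (C - u - v) ⁅ x ⁆ w∈W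
  ... | inj₁ w∈C-u-v = clique-equidistant clique u∈C v∈C w∈C-u-v
  ... | inj₂ w∈⁅x⁆ with x∈⁅y⁆⇒x≡y x w∈⁅x⁆
  ...   | refl = trans (dist≡2 u∈C ¬adj-u) (sym (dist≡2 v∈C ¬adj-v))
    where
    dist≡2 : y ∈ C → ¬ Adj G x y → dist G y x ≡ 2
    dist≡2 {y} y∈C ¬adj = dist-common-neighbour G y≢x (¬adj ∘ Adj-sym G) (clique y c y∈C c∈C y≢c) adj-cx
      where
      y≢x : y ≢ x
      y≢x refl = x∉C y∈C
      y≢c : y ≢ c
      y≢c refl = ¬adj (Adj-sym G adj-cx)

  complete-member-resolves : Complete G → u ∈ W → (∀ w → w ∈ W → dist G u w ≡ dist G v w) → u ≡ v
  complete-member-resolves {u} {W} {v} complete u∈W equidistant with u ≟ v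
  ... | yes u≡v = u≡v
  ... | no u≢v  = contradiction 0≡1 λ ()
    where
    0≡1 : 0 ≡ 1
    0≡1 = begin
      0          ≡⟨ dist-refl G u ⟨
      dist G u u ≡⟨ equidistant u u∈W ⟩
      dist G v u ≡⟨ dist-adj G (complete v u (≢-sym u≢v)) ⟩
      1          ∎
      where open ≡-Reasoning

  complete⇒⊤-x-resolving : Complete G → ∀ z → Resolving G (⊤ - z)
  complete⇒⊤-x-resolving complete z u v equidistant with u ≟ z | v ≟ z
  ... | no u≢z   | _        = complete-member-resolves complete (x∈p∧x≢y⇒x∈p-y ∈⊤ u≢z) equidistant
  ... | yes _    | no v≢z   =
    sym (complete-member-resolves complete (x∈p∧x≢y⇒x∈p-y ∈⊤ v≢z) (λ w w∈W → sym (equidistant w w∈W)))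
  ... | yes refl | yes refl = refl

module RandomlyDimensional {G : Graph n} (randomly : RandomlyDim G k) where

  resolving : ∣ W ∣ ≡ k → Resolving G W
  resolving {W} ∣W∣≡k = proj₁ (proj₂ randomly W ∣W∣≡k)

  clique-size≤1+k : IsClique G C → ∣ C ∣ ≤ suc k
  clique-size≤1+k {C} clique with ∣ C ∣ ≤? suc k
  ... | yes ∣C∣≤1+k = ∣C∣≤1+k
  ... | no ∣C∣≰1+k with ∃-member-removal (≰⇒> ∣C∣≰1+k)
  ... | u , u∈C , 1+k≤∣C-u∣ with ∃-member-removal 1+k≤∣C-u∣
  ... | v , v∈C-u , k≤∣C-u-v∣ with ∃-⊆-of-size (C - u - v) k≤∣C-u-v∣
  ... | W , W⊆C-u-v , ∣W∣≡k =
    contradiction (resolving ∣W∣≡k u v λ w w∈W → clique-equidistant G clique u∈C v∈C (W⊆C-u-v w∈W))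
                  (≢-sym (x∈p-y⇒x≢y v∈C-u))
    where v∈C = p─q⊆p C ⁅ u ⁆ v∈C-u

  complete⇒clique-of-size-1+k : Complete G → Fin n → Σ (Subset n) λ C → IsClique G C × ∣ C ∣ ≡ suc k
  complete⇒clique-of-size-1+k complete z = ⊤ , ⊤-clique , ≤-antisym (clique-size≤1+k ⊤-clique) 1+k≤∣⊤∣
    where
    ⊤-clique : IsClique G ⊤
    ⊤-clique x y _ _ = complete x y
    1+k≤∣⊤∣ : suc k ≤ ∣ ⊤ {n} ∣
    1+k≤∣⊤∣ = subst (suc k ≤_) (x∈p⇒1+∣p-x∣≡∣p∣ {x = z} {p = ⊤} ∈⊤)
                    (s≤s (proj₂ (proj₁ randomly) (⊤ - z) (complete⇒⊤-x-resolving G complete z)))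

  module _ (clique : IsClique G C) (∣C∣≡1+k : ∣ C ∣ ≡ suc k) where

    outsider-misses-clique : x ∉ C → c ∈ C → ∃ λ c′ → c′ ∈ C - c × ¬ Adj G x c′
    outsider-misses-clique {x} {c} x∉C c∈C with any? (λ z → (z ∈? C - c) ×-dec ¬? (Adj? G x z))
    ... | yes found = found
    ... | no  none  = contradiction (resolving ∣C-c∣≡k x c equidistant) λ { refl → x∉C c∈C }
      where
      ∣C-c∣≡k : ∣ C - c ∣ ≡ k
      ∣C-c∣≡k = suc-injective (trans (x∈p⇒1+∣p-x∣≡∣p∣ c∈C) ∣C∣≡1+k)
      equidistant : ∀ w → w ∈ C - c → dist G x w ≡ dist G c w
      equidistant w w∈C-c with Adj? G x w
      ... | yes adj = trans (dist-adj G adj) (sym (clique-dist≡1 G clique c∈C w∈C-c))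
      ... | no ¬adj = contradiction (w , w∈C-c , ¬adj) none

    max-clique-closed : AdjClosed G C
    max-clique-closed {c} {x} c∈C adj-cx with x ∈? C
    ... | yes x∈C = x∈C
    ... | no  x∉C with outsider-misses-clique x∉C c∈C
    ... | c₁ , c₁∈C-c , ¬adj₁ with outsider-misses-clique x∉C (p─q⊆p C ⁅ c ⁆ c₁∈C-c)
    ... | c₂ , c₂∈C-c₁ , ¬adj₂ =
      contradiction (resolving ∣W∣≡k c₁ c₂ λ w →
                       clique-equidistant-with-outsider G clique c∈C adj-cx x∉C c₁∈C c₂∈C ¬adj₁ ¬adj₂)
                    (≢-sym (x∈p-y⇒x≢y c₂∈C-c₁))
      where
      c₁∈C = p─q⊆p C ⁅ c ⁆ c₁∈C-c
      c₂∈C = p─q⊆p C ⁅ c₁ ⁆ c₂∈C-c₁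
      ∣W∣≡k : ∣ (C - c₁ - c₂) ∪ ⁅ x ⁆ ∣ ≡ k
      ∣W∣≡k = suc-injective (begin
        suc ∣ (C - c₁ - c₂) ∪ ⁅ x ⁆ ∣  ≡⟨ cong suc (x∉p⇒∣p∪⁅x⁆∣≡1+∣p∣ (x∉C ∘ p─q⊆p C _ ∘ p─q⊆p (C - c₁) _)) ⟩
        suc (suc ∣ C - c₁ - c₂ ∣)      ≡⟨ cong suc (x∈p⇒1+∣p-x∣≡∣p∣ c₂∈C-c₁) ⟩
        suc ∣ C - c₁ ∣                 ≡⟨ x∈p⇒1+∣p-x∣≡∣p∣ c₁∈C ⟩
        ∣ C ∣                          ≡⟨ ∣C∣≡1+k ⟩
        suc k                          ∎)
        where open ≡-Reasoning

  clique-of-size-1+k⇒complete : Connected G → Σ (Subset n) (λ C → IsClique G C × ∣ C ∣ ≡ suc k) → Complete G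
  clique-of-size-1+k⇒complete connected (C , clique , ∣C∣≡1+k) x y = clique x y (everywhere x) (everywhere y)
    where
    everywhere : ∀ y → y ∈ C
    everywhere = connected∧closed⇒∈ G connected (0<∣p∣⇒Nonempty (subst (0 <_) (sym ∣C∣≡1+k) (s≤s z≤n)))
                                                 (max-clique-closed clique ∣C∣≡1+k)

mainTheorem9 : (n : ℕ) → 2 ≤ n → (G : Graph n) → Connected G → (k : ℕ) → RandomlyDim G k
    → (∀ C → IsClique G C → ∣ C ∣ ≤ suc k)
    × ((Σ (Subset n) λ C → IsClique G C × ∣ C ∣ ≡ suc k) ⇔ Complete G)
mainTheorem9 zero    ()
mainTheorem9 (suc n) _ G connected k randomly =
  (λ C → clique-size≤1+k) ,
  mk⇔ (clique-of-size-1+k⇒complete connected) (λ complete → complete⇒clique-of-size-1+k complete zero)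
  where open RandomlyDimensional randomly
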